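{- Let $G$ be a bipartite multigraph and let $H$ be a subgraph of $G$ such that $E(H)$ is a clique in $L(G)^2$. Then $|E(H)| \leq \Delta(H)\bigl(\sigma_G(H)-\Delta(H)\bigr) \leq \frac{1}{4}\sigma_G(H)^2$, where $\sigma_G(H)=\max_{xy\in E(H)}(d_G(x)+d_G(y))$.
   Context: For a (multi)graph $G$, $L(G)^2$ denotes the square of the line graph of $G$: its vertices are the edges of $G$, and two distinct edges $e,f$ of $G$ are adjacent in $L(G)^2$ if and only if they share an end, or some edge of $G$ joins an end of $e$ to an end of $f$. A set of edges is a clique in $L(G)^2$ if its elements are pairwise adjacent in $L(G)^2$. Degrees in a multigraph count multiplicity; $\Delta(H)$ is the maximum degree of $H$. $\sigma_G(H)$ is the Ore-degree of $H$ in $G$ (taken to be $0$ if $H$ has no edges). -}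

module Defs where

open import Data.Nat using (ℕ; _+_; _⊔_)
open import Data.Bool using (Bool; true; false; if_then_else_)
open import Data.Fin using (Fin; _≟_)
open import Data.List using (List; map; foldr; allFin)
open import Data.Nat.ListAction using (sum)
open import Data.Product using (_×_; proj₁; proj₂; ∃)
open import Data.Sum using (_⊎_)
open import Relation.Binary.PropositionalEquality using (_≡_; _≢_)
open import Relation.Nullary.Decidable using (⌊_⌋)

-- A finite multigraph: vertices Fin n, edges Fin m, each edge e has an
-- (ordered representation of its unordered) pair of ends  ends e .
-- Parallel edges are allowed (ends need not be injective).
record Multigraph : Set where
  field
    n    : ℕ
    m    : ℕ
    ends : Fin m → Fin n × Fin n

open Multigraph public

module _ (G : Multigraph) where

  end₁ end₂ : Fin (m G) → Fin (n G)
  end₁ e = proj₁ (ends G e)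
  end₂ e = proj₂ (ends G e)

  Bipartite : Set
  Bipartite = ∃ λ (col : Fin (n G) → Bool) → ∀ e → col (end₁ e) ≢ col (end₂ e)

  IsEnd : Fin (n G) → Fin (m G) → Set
  IsEnd v e = (v ≡ end₁ e) ⊎ (v ≡ end₂ e)

  AdjL² : Fin (m G) → Fin (m G) → Set
  AdjL² e f =
    (∃ λ v → IsEnd v e × IsEnd v f)
    ⊎ (∃ λ g → (IsEnd (end₁ g) e × IsEnd (end₂ g) f)
             ⊎ (IsEnd (end₂ g) e × IsEnd (end₁ g) f))

  -- edge subsets (a subgraph H is represented by its edge set E(H) ⊆ E(G))
  EdgeSet : Set
  EdgeSet = Fin (m G) → Bool

  IsCliqueL² : EdgeSet → Set
  IsCliqueL² H = ∀ e f → H e ≡ true → H f ≡ true → e ≢ f → AdjL² e f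

  [_] : Bool → ℕ
  [ true ] = 1
  [ false ] = 0

  size : EdgeSet → ℕ
  size H = sum (map (λ e → [ H e ]) (allFin (m G)))

  -- degree of v in H (multiplicity counted; a loop counts twice)
  degIn : EdgeSet → Fin (n G) → ℕ
  degIn H v = sum (map (λ e → if H e
                                then [ ⌊ v ≟ end₁ e ⌋ ] + [ ⌊ v ≟ end₂ e ⌋ ]
                                else 0) (allFin (m G)))

  deg : Fin (n G) → ℕ
  deg = degIn (λ _ → true)

  Δ : EdgeSet → ℕ
  Δ H = foldr _⊔_ 0 (map (degIn H) (allFin (n G)))

  -- Ore-degree σ_G(H) = max over xy ∈ E(H) of d_G(x) + d_G(y); 0 if E(H) = ∅
  σ : EdgeSet → ℕ
  σ H = foldr _⊔_ 0 (map (λ e → if H e then deg (end₁ e) + deg (end₂ e) else 0)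
                         (allFin (m G)))

-- Let u be a vertex of maximum H-degree D = Δ(H), orient every edge from the colour
-- class of u (its left end) to the other class (its right end), and let D̃ = d_G(u) − D
-- count the G-edges at u outside H. An H-edge f either shares its right end with one of
-- these D̃ edges, or it is lonely. Every right end carries at most D edges of H, so at
-- most D·D̃ H-edges are of the first kind. Fix a left vertex v. If v is joined to the
-- right end of every H-edge at u, the lonely H-edges at v number at most d_H(v) ≤ D.
-- Otherwise some H-edge e₀ at u has a right end with no edge to v, and adjacency of f
-- and e₀ in L(G)² then forces each lonely f at v to share its right end with an H-edge
-- at u. Either way the lonely H-edges at v are at most the edges from v to right ends
-- of H-edges at u; summing over v bounds them by the sum of d_G(w) over those right
-- ends w, which is at most D(σ − d_G(u)) because d_G(u) + d_G(w) ≤ σ. Hence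
-- |E(H)| ≤ D·D̃ + D(σ − D − D̃) = D(σ − D), and the second bound is 4xy ≤ (x + y)².

module Submission where

open import Data.Bool using (Bool; true; false; not)
import Data.Bool as Bool
open import Data.Bool.Properties using (¬-not)
open import Data.Empty using (⊥; ⊥-elim)
open import Data.Fin using (Fin; zero; suc; _≟_)
open import Data.Fin.Properties using (any?)
import Data.Fin.Properties as Finₚ
open import Data.List as List using (allFin)
open import Data.List.Properties using (map-tabulate)
open import Data.Nat using (ℕ; zero; suc; _+_; _*_; _∸_; _≤_; _⊔_; _≡ᵇ_; z≤n; s≤s)
import Data.Nat as ℕ
open import Data.Nat.Properties hiding (_≟_)
open import Data.Nat.Tactic.RingSolver using (solve-∀)
open import Data.Product using (_×_; _,_; ∃)
open import Data.Sum using (_⊎_; inj₁; inj₂; swap)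
import Data.Sum as Sum
open import Data.Vec.Functional as Vector using (Vector)
open import Function using (_∘_; id)
open import Relation.Binary.PropositionalEquality hiding ([_])
open import Relation.Nullary using (¬_; Dec; yes; no; _×-dec_)
open import Relation.Nullary.Decidable using (⌊_⌋)

open import Algebra.Properties.CommutativeSemigroup *-commutativeSemigroup using (x∙yz≈y∙xz)
open import Algebra.Properties.Semiring.Sum +-*-semiring
  using (sum; sum-cong-≗; sum-replicate-zero; ∑-comm; ∑-distrib-+; *-distribˡ-sum; *-distribʳ-sum)

open import Defs

foldr-map-allFin : ∀ {A B : Set} (_∙_ : A → B → B) (z : B) {k} (f : Fin k → A) →
                   List.foldr _∙_ z (List.map f (allFin k)) ≡ Vector.foldr _∙_ z f
foldr-map-allFin _∙_ z f = trans (cong (List.foldr _∙_ z) (map-tabulate id f)) (foldr-tabulate f)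
  where
  foldr-tabulate : ∀ {k} (f : Fin k → _) → List.foldr _∙_ z (List.tabulate f) ≡ Vector.foldr _∙_ z f
  foldr-tabulate {zero} f = refl
  foldr-tabulate {suc k} f = cong (f zero ∙_) (foldr-tabulate (f ∘ suc))

sum-mono-≤ : ∀ {k} {f g : Vector ℕ k} → (∀ i → f i ≤ g i) → sum f ≤ sum g
sum-mono-≤ {zero} f≤g = z≤n
sum-mono-≤ {suc k} f≤g = +-mono-≤ (f≤g zero) (sum-mono-≤ (f≤g ∘ suc))

≤-sum : ∀ {k} (f : Vector ℕ k) i → f i ≤ sum f
≤-sum f zero = m≤m+n _ _
≤-sum f (suc i) = ≤-trans (≤-sum (f ∘ suc) i) (m≤n+m _ (f zero))

sum≡0⇒≡0 : ∀ {k} (f : Vector ℕ k) i → sum f ≡ 0 → f i ≡ 0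
sum≡0⇒≡0 f i sum≡0 = n≤0⇒n≡0 (≤-trans (≤-sum f i) (≤-reflexive sum≡0))

maximum : ∀ {k} → Vector ℕ k → ℕ
maximum = Vector.foldr _⊔_ 0

≤-maximum : ∀ {k} (f : Vector ℕ k) i → f i ≤ maximum f
≤-maximum f zero = m≤m⊔n _ _
≤-maximum f (suc i) = ≤-trans (≤-maximum (f ∘ suc) i) (m≤n⊔m (f zero) _)

maximum-attained : ∀ {k} (f : Vector ℕ k) → Fin k → ∃ λ i → maximum f ≡ f i
maximum-attained {suc zero} f _ = zero , ⊔-identityʳ (f zero)
maximum-attained {suc (suc k)} f _ =
  choose (⊔-sel (f zero) (maximum (f ∘ suc))) (maximum-attained (f ∘ suc) zero)
  where
  choose : _ ⊎ _ → (∃ λ i → maximum (f ∘ suc) ≡ f (suc i)) → ∃ λ i → maximum f ≡ f i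
  choose (inj₁ max≡f₀) _ = zero , max≡f₀
  choose (inj₂ max≡rest) (i , rest≡fᵢ) = suc i , trans max≡rest rest≡fᵢ

𝟙 : Bool → ℕ
𝟙 true = 1
𝟙 false = 0

𝟙≤1 : ∀ b → 𝟙 b ≤ 1
𝟙≤1 true = ≤-refl
𝟙≤1 false = z≤n

𝟙-split : ∀ b x → x ≡ 𝟙 b * x + 𝟙 (not b) * x
𝟙-split true x = sym (trans (+-identityʳ (x + 0)) (+-identityʳ x))
𝟙-split false x = sym (+-identityʳ x)

_==_ : ∀ {k} → Fin k → Fin k → Bool
x == y = ⌊ x ≟ y ⌋

==-≡ : ∀ {k} {x y : Fin k} → x ≡ y → (x == y) ≡ true
==-≡ {x = x} {y} x≡y with x ≟ y
... | yes _ = refl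
... | no x≢y = ⊥-elim (x≢y x≡y)

==-≢ : ∀ {k} {x y : Fin k} → x ≢ y → (x == y) ≡ false
==-≢ {x = x} {y} x≢y with x ≟ y
... | yes x≡y = ⊥-elim (x≢y x≡y)
... | no _ = refl

suc==suc : ∀ {k} {v x : Fin k} → Dec (v ≡ x) → (suc v == suc x) ≡ (v == x)
suc==suc (yes v≡x) = trans (==-≡ (cong suc v≡x)) (sym (==-≡ v≡x))
suc==suc (no v≢x) = trans (==-≢ (v≢x ∘ Finₚ.suc-injective)) (sym (==-≢ v≢x))

sum-𝟙== : ∀ {k} (x : Fin k) → sum (λ v → 𝟙 (v == x)) ≡ 1
sum-𝟙== {suc k} zero = cong suc (sum-replicate-zero k)
sum-𝟙== {suc k} (suc x) = trans (sum-cong-≗ (λ v → cong 𝟙 (suc==suc (v ≟ x)))) (sum-𝟙== x)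

x≢y∧x≢z⇒y≡z : ∀ {x y z : Bool} → x ≢ y → x ≢ z → y ≡ z
x≢y∧x≢z⇒y≡z x≢y x≢z = trans (¬-not (x≢y ∘ sym)) (sym (¬-not (x≢z ∘ sym)))

4*[m*[m+j]]≤[m+[m+j]]² : ∀ m j → 4 * (m * (m + j)) ≤ (m + (m + j)) * (m + (m + j))
4*[m*[m+j]]≤[m+[m+j]]² m j = subst (4 * (m * (m + j)) ≤_) (sym (square m j)) (m≤m+n _ (j * j))
  where
  square : ∀ m j → (m + (m + j)) * (m + (m + j)) ≡ 4 * (m * (m + j)) + j * j
  square = solve-∀

4*[m*n]≤[m+n]² : ∀ m n → 4 * (m * n) ≤ (m + n) * (m + n)
4*[m*n]≤[m+n]² m n with ≤-total m n
... | inj₁ m≤n with m≤n⇒∃[o]m+o≡n m≤n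
...   | j , refl = 4*[m*[m+j]]≤[m+[m+j]]² m j
4*[m*n]≤[m+n]² m n | inj₂ n≤m with m≤n⇒∃[o]m+o≡n n≤m
...   | j , refl = subst₂ (λ a b → 4 * a ≤ b * b) (*-comm n (n + j)) (+-comm n (n + j))
                          (4*[m*[m+j]]≤[m+[m+j]]² n j)

4*[m*[n∸m]]≤n² : ∀ m n → 4 * (m * (n ∸ m)) ≤ n * n
4*[m*[n∸m]]≤n² m n with ≤-total m n
... | inj₁ m≤n with m≤n⇒∃[o]m+o≡n m≤n
...   | k , refl = subst (λ a → 4 * (m * a) ≤ (m + k) * (m + k)) (sym (m+n∸m≡n m k)) (4*[m*n]≤[m+n]² m k)
4*[m*[n∸m]]≤n² m n | inj₂ n≤m rewrite m≤n⇒m∸n≡0 n≤m | *-zeroʳ m = z≤n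

x≤d*a+l∧d*[d+a]+l≤d*s⇒x≤d*[s∸d] : ∀ {x d a l s} → x ≤ d * a + l → d * (d + a) + l ≤ d * s →
                                   x ≤ d * (s ∸ d)
x≤d*a+l∧d*[d+a]+l≤d*s⇒x≤d*[s∸d] {x} {d} {a} {l} {s} x≤ ≤d*s =
  subst (x ≤_) (sym (*-distribˡ-∸ d s d)) (m+n≤o⇒m≤o∸n x (+-cancelʳ-≤ (d * a) _ _ (begin
    x + d * d + d * a        ≡⟨ +-assoc x (d * d) (d * a) ⟩
    x + (d * d + d * a)      ≡⟨ cong (x +_) (sym (*-distribˡ-+ d d a)) ⟩
    x + d * (d + a)          ≤⟨ +-monoˡ-≤ (d * (d + a)) x≤ ⟩
    d * a + l + d * (d + a)  ≡⟨ trans (+-assoc (d * a) l _) (cong (d * a +_) (+-comm l _)) ⟩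
    d * a + (d * (d + a) + l) ≤⟨ +-monoʳ-≤ (d * a) ≤d*s ⟩
    d * a + d * s            ≡⟨ +-comm (d * a) (d * s) ⟩
    d * s + d * a            ∎)))
  where open ≤-Reasoning

module _ (G : Multigraph) where

  incidence : Fin (n G) → Fin (m G) → ℕ
  incidence v e = 𝟙 (v == end₁ G e) + 𝟙 (v == end₂ G e)

  private
    [b]≡𝟙b : ∀ b → [_] G b ≡ 𝟙 b
    [b]≡𝟙b true = refl
    [b]≡𝟙b false = refl

  size≡sum : ∀ H → size G H ≡ sum (λ e → 𝟙 (H e))
  size≡sum H = trans (foldr-map-allFin _+_ 0 {m G} _) (sum-cong-≗ (λ e → [b]≡𝟙b (H e)))

  degIn≡sum : ∀ H v → degIn G H v ≡ sum (λ e → 𝟙 (H e) * incidence v e)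
  degIn≡sum H v = trans (foldr-map-allFin _+_ 0 {m G} _) (sum-cong-≗ term)
    where
    term : ∀ e → (Bool.if H e then [_] G (v == end₁ G e) + [_] G (v == end₂ G e) else 0)
                 ≡ 𝟙 (H e) * incidence v e
    term e with H e
    ... | true = trans (cong₂ _+_ ([b]≡𝟙b (v == end₁ G e)) ([b]≡𝟙b (v == end₂ G e)))
                       (sym (+-identityʳ _))
    ... | false = refl

  deg≡sum : ∀ v → deg G v ≡ sum (incidence v)
  deg≡sum v = trans (degIn≡sum _ v) (sum-cong-≗ (λ e → +-identityʳ (incidence v e)))

  size≡0 : ∀ H → ¬ Fin (n G) → size G H ≡ 0
  size≡0 H noVertex = trans (size≡sum H)
    (trans (sum-cong-≗ (λ e → ⊥-elim (noVertex (end₁ G e)))) (sum-replicate-zero (m G)))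

  degIn≤Δ : ∀ H v → degIn G H v ≤ Δ G H
  degIn≤Δ H v = subst (degIn G H v ≤_) (sym (foldr-map-allFin _⊔_ 0 (degIn G H))) (≤-maximum (degIn G H) v)

  Δ-attained : ∀ H → Fin (n G) → ∃ λ u → Δ G H ≡ degIn G H u
  Δ-attained H v with maximum-attained (degIn G H) v
  ... | u , max≡ = u , trans (foldr-map-allFin _⊔_ 0 (degIn G H)) max≡

  deg-ends≤σ : ∀ H e → H e ≡ true → deg G (end₁ G e) + deg G (end₂ G e) ≤ σ G H
  deg-ends≤σ H e He = subst₂ _≤_ (cong (λ b → Bool.if b then _ else 0) He)
    (sym (foldr-map-allFin _⊔_ 0 {m G} _)) (≤-maximum _ e)

module Orientation (G : Multigraph) (col : Fin (n G) → Bool)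
  (proper : ∀ e → col (end₁ G e) ≢ col (end₂ G e)) (c : Bool) where

  left right : Fin (m G) → Fin (n G)
  left e with col (end₁ G e) Bool.≟ c
  ... | yes _ = end₁ G e
  ... | no _ = end₂ G e
  right e with col (end₁ G e) Bool.≟ c
  ... | yes _ = end₂ G e
  ... | no _ = end₁ G e

  end≡left : ∀ {w e} → IsEnd G w e → col w ≡ c → w ≡ left e
  end≡left {w} {e} w∈e cw with col (end₁ G e) Bool.≟ c | w∈e
  ... | yes _ | inj₁ w≡e₁ = w≡e₁
  ... | yes c₁ | inj₂ refl = ⊥-elim (proper e (trans c₁ (sym cw)))
  ... | no ¬c₁ | inj₁ refl = ⊥-elim (¬c₁ cw)
  ... | no _ | inj₂ w≡e₂ = w≡e₂

  end≡right : ∀ {w e} → IsEnd G w e → col w ≢ c → w ≡ right e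
  end≡right {w} {e} w∈e ¬cw with col (end₁ G e) Bool.≟ c | w∈e
  ... | yes c₁ | inj₁ refl = ⊥-elim (¬cw c₁)
  ... | yes _ | inj₂ w≡e₂ = w≡e₂
  ... | no _ | inj₁ w≡e₁ = w≡e₁
  ... | no ¬c₁ | inj₂ refl = ⊥-elim (¬cw (x≢y∧x≢z⇒y≡z (proper e) ¬c₁))

  col-right : ∀ e → col (right e) ≢ c
  col-right e with col (end₁ G e) Bool.≟ c
  ... | yes c₁ = λ c₂ → proper e (trans c₁ (sym c₂))
  ... | no ¬c₁ = ¬c₁

  left+right≡end₁+end₂ : ∀ (f : Fin (n G) → ℕ) e →
                         f (left e) + f (right e) ≡ f (end₁ G e) + f (end₂ G e)
  left+right≡end₁+end₂ f e with col (end₁ G e) Bool.≟ c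
  ... | yes _ = refl
  ... | no _ = +-comm (f (end₂ G e)) _

  incidence≡ : ∀ v e → incidence G v e ≡ 𝟙 (v == left e) + 𝟙 (v == right e)
  incidence≡ v e = sym (left+right≡end₁+end₂ (λ w → 𝟙 (v == w)) e)

  incidence-left : ∀ {v} e → col v ≡ c → incidence G v e ≡ 𝟙 (v == left e)
  incidence-left {v} e cv = begin
    incidence G v e                          ≡⟨ incidence≡ v e ⟩
    𝟙 (v == left e) + 𝟙 (v == right e)      ≡⟨ cong (λ b → 𝟙 (v == left e) + 𝟙 b) (==-≢ v≢right) ⟩
    𝟙 (v == left e) + 0                      ≡⟨ +-identityʳ _ ⟩
    𝟙 (v == left e)                          ∎
    where
    open ≡-Reasoning
    v≢right : v ≢ right e
    v≢right v≡right = col-right e (trans (cong col (sym v≡right)) cv)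

  𝟙==left≤incidence : ∀ v e → 𝟙 (v == left e) ≤ incidence G v e
  𝟙==left≤incidence v e = subst (𝟙 (v == left e) ≤_) (sym (incidence≡ v e)) (m≤m+n _ _)

  𝟙==right≤incidence : ∀ v e → 𝟙 (v == right e) ≤ incidence G v e
  𝟙==right≤incidence v e = subst (𝟙 (v == right e) ≤_) (sym (incidence≡ v e)) (m≤n+m _ _)

  Link : Fin (m G) → Fin (m G) → Set
  Link e f = ∃ λ g → left g ≡ left e × right g ≡ right f

  shared-end : ∀ {w e f} → IsEnd G w e → IsEnd G w f → left e ≡ left f ⊎ right e ≡ right f
  shared-end {w} w∈e w∈f with col w Bool.≟ c
  ... | yes cw = inj₁ (trans (sym (end≡left w∈e cw)) (end≡left w∈f cw))
  ... | no ¬cw = inj₂ (trans (sym (end≡right w∈e ¬cw)) (end≡right w∈f ¬cw))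

  joined : ∀ g {e f} → IsEnd G (end₁ G g) e → IsEnd G (end₂ G g) f → Link e f ⊎ Link f e
  joined g g₁∈e g₂∈f with col (end₁ G g) Bool.≟ c
  ... | yes c₁ = inj₁ (g , trans (sym (end≡left (inj₁ refl) c₁)) (end≡left g₁∈e c₁)
                         , trans (sym (end≡right (inj₂ refl) ¬c₂)) (end≡right g₂∈f ¬c₂))
    where
    ¬c₂ : col (end₂ G g) ≢ c
    ¬c₂ c₂ = proper g (trans c₁ (sym c₂))
  ... | no ¬c₁ = inj₂ (g , trans (sym (end≡left (inj₂ refl) c₂)) (end≡left g₂∈f c₂)
                         , trans (sym (end≡right (inj₁ refl) ¬c₁)) (end≡right g₁∈e ¬c₁))
    where
    c₂ : col (end₂ G g) ≡ c
    c₂ = x≢y∧x≢z⇒y≡z (proper g) ¬c₁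

  adjacent-cases : ∀ {e f} → AdjL² G e f →
                   left e ≡ left f ⊎ right e ≡ right f ⊎ Link e f ⊎ Link f e
  adjacent-cases (inj₁ (w , w∈e , w∈f)) = Sum.map₂ inj₁ (shared-end w∈e w∈f)
  adjacent-cases (inj₂ (g , inj₁ (g₁∈e , g₂∈f))) = inj₂ (inj₂ (joined g g₁∈e g₂∈f))
  adjacent-cases (inj₂ (g , inj₂ (g₂∈e , g₁∈f))) = inj₂ (inj₂ (swap (joined g g₁∈f g₂∈e)))

module CliqueBound (G : Multigraph) (col : Fin (n G) → Bool)
  (proper : ∀ e → col (end₁ G e) ≢ col (end₂ G e))
  (H : EdgeSet G) (clique : IsCliqueL² G H)
  (u : Fin (n G)) (u-max : ∀ v → degIn G H v ≤ degIn G H u) where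

  open Orientation G col proper (col u)

  D : ℕ
  D = degIn G H u

  H-at-u non-H-at-u : Fin (m G) → ℕ
  H-at-u e = 𝟙 (H e) * 𝟙 (u == left e)
  non-H-at-u e = 𝟙 (not (H e)) * 𝟙 (u == left e)

  H-at-u≡1 : ∀ {e} → H e ≡ true → u ≡ left e → H-at-u e ≡ 1
  H-at-u≡1 He u≡left rewrite He | ==-≡ u≡left = refl

  non-H-at-u≡1 : ∀ {e} → H e ≡ false → u ≡ left e → non-H-at-u e ≡ 1
  non-H-at-u≡1 He u≡left rewrite He | ==-≡ u≡left = refl

  D̃ far-degrees : ℕ
  D̃ = sum non-H-at-u
  far-degrees = sum (λ e → H-at-u e * deg G (right e))

  D≡sum : D ≡ sum H-at-u
  D≡sum = trans (degIn≡sum G H u) (sum-cong-≗ (λ e → cong (𝟙 (H e) *_) (incidence-left e refl)))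

  deg-u≡ : deg G u ≡ D + D̃
  deg-u≡ = begin
    deg G u
      ≡⟨ deg≡sum G u ⟩
    sum (incidence G u)
      ≡⟨ sum-cong-≗ (λ e → trans (incidence-left e refl) (𝟙-split (H e) _)) ⟩
    sum (λ e → H-at-u e + non-H-at-u e)
      ≡⟨ ∑-distrib-+ H-at-u non-H-at-u ⟩
    sum H-at-u + D̃
      ≡⟨ cong (_+ D̃) (sym D≡sum) ⟩
    D + D̃ ∎
    where open ≡-Reasoning

  H-edges-at-right≤D : ∀ w → sum (λ f → 𝟙 (H f) * 𝟙 (w == right f)) ≤ D
  H-edges-at-right≤D w = ≤-trans (sum-mono-≤ (λ f → *-monoʳ-≤ (𝟙 (H f)) (𝟙==right≤incidence w f)))
                                 (subst (_≤ D) (degIn≡sum G H w) (u-max w))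

  partners : Fin (m G) → ℕ
  partners f = sum (λ g → non-H-at-u g * 𝟙 (right g == right f))

  lonely : Fin (m G) → ℕ
  lonely f = 𝟙 (H f) * 𝟙 (partners f ≡ᵇ 0)

  lonely≤𝟙H : ∀ f → lonely f ≤ 𝟙 (H f)
  lonely≤𝟙H f = ≤-trans (*-monoʳ-≤ (𝟙 (H f)) (𝟙≤1 _)) (≤-reflexive (*-identityʳ _))

  𝟙H≤partnered+lonely : ∀ f → 𝟙 (H f) ≤ 𝟙 (H f) * partners f + lonely f
  𝟙H≤partnered+lonely f with H f | partners f
  ... | false | _ = z≤n
  ... | true | zero = ≤-refl
  ... | true | suc _ = s≤s z≤n

  partnered≤ : sum (λ f → 𝟙 (H f) * partners f) ≤ D * D̃
  partnered≤ = begin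
    sum (λ f → 𝟙 (H f) * partners f)
      ≡⟨ sum-cong-≗ (λ f → *-distribˡ-sum (𝟙 (H f)) (λ g → non-H-at-u g * 𝟙 (right g == right f))) ⟩
    sum (λ f → sum (λ g → 𝟙 (H f) * (non-H-at-u g * 𝟙 (right g == right f))))
      ≡⟨ ∑-comm (λ f g → 𝟙 (H f) * (non-H-at-u g * 𝟙 (right g == right f))) ⟩
    sum (λ g → sum (λ f → 𝟙 (H f) * (non-H-at-u g * 𝟙 (right g == right f))))
      ≡⟨ sum-cong-≗ (λ g → trans (sum-cong-≗ (λ f → x∙yz≈y∙xz (𝟙 (H f)) (non-H-at-u g) _))
                                  (sym (*-distribˡ-sum (non-H-at-u g) (λ f → 𝟙 (H f) * 𝟙 (right g == right f))))) ⟩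
    sum (λ g → non-H-at-u g * sum (λ f → 𝟙 (H f) * 𝟙 (right g == right f)))
      ≤⟨ sum-mono-≤ (λ g → *-monoʳ-≤ (non-H-at-u g) (H-edges-at-right≤D (right g))) ⟩
    sum (λ g → non-H-at-u g * D)
      ≡⟨ sym (*-distribʳ-sum D non-H-at-u) ⟩
    D̃ * D
      ≡⟨ *-comm _ D ⟩
    D * D̃ ∎
    where open ≤-Reasoning

  μ : Fin (n G) → Fin (n G) → ℕ
  μ v w = sum (λ g → 𝟙 (v == left g) * 𝟙 (w == right g))

  sum-μ≤deg : ∀ w → sum (λ v → μ v w) ≤ deg G w
  sum-μ≤deg w = begin
    sum (λ v → μ v w)
      ≡⟨ ∑-comm (λ v g → 𝟙 (v == left g) * 𝟙 (w == right g)) ⟩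
    sum (λ g → sum (λ v → 𝟙 (v == left g) * 𝟙 (w == right g)))
      ≡⟨ sum-cong-≗ (λ g → trans (sym (*-distribʳ-sum _ (λ v → 𝟙 (v == left g))))
                                  (cong (_* 𝟙 (w == right g)) (sum-𝟙== (left g)))) ⟩
    sum (λ g → 1 * 𝟙 (w == right g))
      ≤⟨ sum-mono-≤ (λ g → subst (_≤ incidence G w g) (sym (*-identityˡ _)) (𝟙==right≤incidence w g)) ⟩
    sum (incidence G w)
      ≡⟨ sym (deg≡sum G w) ⟩
    deg G w ∎
    where open ≤-Reasoning

  no-edge : ∀ {v w} → μ v w ≡ 0 → ∀ g → left g ≡ v → right g ≡ w → ⊥
  no-edge {v} {w} μ≡0 g left-g right-g =
    1+n≢0 (trans (sym edge≡1) (sum≡0⇒≡0 (λ g → 𝟙 (v == left g) * 𝟙 (w == right g)) g μ≡0))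
    where
    edge≡1 : 𝟙 (v == left g) * 𝟙 (w == right g) ≡ 1
    edge≡1 = cong₂ (λ a b → 𝟙 a * 𝟙 b) (==-≡ (sym left-g)) (==-≡ (sym right-g))

  Gap : Fin (n G) → Fin (m G) → Set
  Gap v e = H e ≡ true × u ≡ left e × μ v (right e) ≡ 0

  gap? : ∀ v e → Dec (Gap v e)
  gap? v e = (H e Bool.≟ true) ×-dec (u ≟ left e) ×-dec (μ v (right e) ℕ.≟ 0)

  partner-at-u : ∀ {v e₀ f} → Gap v e₀ → H f ≡ true → left f ≡ v → partners f ≡ 0 →
                 ∃ λ e → H e ≡ true × u ≡ left e × right e ≡ right f
  partner-at-u {v} {e₀} {f} (He₀ , u≡e₀ , μ≡0) Hf left-f≡v p≡0
    with adjacent-cases (clique f e₀ Hf He₀ (λ { refl → no-edge μ≡0 f left-f≡v refl }))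
  ... | inj₁ left≡ = ⊥-elim (no-edge μ≡0 e₀ (trans (sym left≡) left-f≡v) refl)
  ... | inj₂ (inj₁ right≡) = e₀ , He₀ , u≡e₀ , sym right≡
  ... | inj₂ (inj₂ (inj₁ (g , left-g , right-g))) = ⊥-elim (no-edge μ≡0 g (trans left-g left-f≡v) right-g)
  ... | inj₂ (inj₂ (inj₂ (g , left-g , right-g))) with H g in Hg
  ...   | true = g , Hg , trans u≡e₀ (sym left-g) , right-g
  ...   | false = ⊥-elim (1+n≢0 (trans (sym partner≡1) (sum≡0⇒≡0 _ g p≡0)))
    where
    partner≡1 : non-H-at-u g * 𝟙 (right g == right f) ≡ 1
    partner≡1 = cong₂ (λ a b → a * 𝟙 b) (non-H-at-u≡1 Hg (trans u≡e₀ (sym left-g))) (==-≡ right-g)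

  H-at-u≤H-at-u*μ : ∀ {v} e → ¬ Gap v e → H-at-u e ≤ H-at-u e * μ v (right e)
  H-at-u≤H-at-u*μ {v} e ¬gap with H e | u ≟ left e | μ v (right e)
  ... | false | _ | _ = z≤n
  ... | true | no _ | _ = z≤n
  ... | true | yes u≡left | zero = ⊥-elim (¬gap (refl , u≡left , refl))
  ... | true | yes _ | suc _ = s≤s z≤n

  lonely-at≤ : ∀ v → sum (λ f → 𝟙 (v == left f) * lonely f) ≤ sum (λ e → H-at-u e * μ v (right e))
  lonely-at≤ v with any? (gap? v)
  ... | no no-gap = begin
    sum (λ f → 𝟙 (v == left f) * lonely f)
      ≤⟨ sum-mono-≤ (λ f → subst (𝟙 (v == left f) * lonely f ≤_) (*-comm (incidence G v f) _)
                                  (*-mono-≤ (𝟙==left≤incidence v f) (lonely≤𝟙H f))) ⟩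
    sum (λ f → 𝟙 (H f) * incidence G v f)
      ≡⟨ sym (degIn≡sum G H v) ⟩
    degIn G H v
      ≤⟨ u-max v ⟩
    D
      ≡⟨ D≡sum ⟩
    sum H-at-u
      ≤⟨ sum-mono-≤ (λ e → H-at-u≤H-at-u*μ {v} e (λ gap → no-gap (e , gap))) ⟩
    sum (λ e → H-at-u e * μ v (right e)) ∎
    where open ≤-Reasoning
  ... | yes (e₀ , gap) = begin
    sum (λ f → 𝟙 (v == left f) * lonely f)
      ≤⟨ sum-mono-≤ lonely-term≤ ⟩
    sum (λ f → sum (λ e → H-at-u e * (𝟙 (v == left f) * 𝟙 (right e == right f))))
      ≡⟨ ∑-comm (λ f e → H-at-u e * (𝟙 (v == left f) * 𝟙 (right e == right f))) ⟩
    sum (λ e → sum (λ f → H-at-u e * (𝟙 (v == left f) * 𝟙 (right e == right f))))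
      ≡⟨ sum-cong-≗ (λ e → sym (*-distribˡ-sum (H-at-u e) (λ f → 𝟙 (v == left f) * 𝟙 (right e == right f)))) ⟩
    sum (λ e → H-at-u e * μ v (right e)) ∎
    where
    open ≤-Reasoning
    lonely-term≤ : ∀ f → 𝟙 (v == left f) * lonely f
                         ≤ sum (λ e → H-at-u e * (𝟙 (v == left f) * 𝟙 (right e == right f)))
    lonely-term≤ f with v ≟ left f | H f in Hf | partners f in p≡
    ... | no _ | _ | _ = z≤n
    ... | yes _ | false | _ = z≤n
    ... | yes _ | true | suc _ = z≤n
    ... | yes v≡left | true | zero with partner-at-u gap Hf (sym v≡left) p≡
    ...   | e , He , u≡left , right≡ = ≤-trans (≤-reflexive (sym partner≡1)) (≤-sum _ e)
      where
      partner≡1 : H-at-u e * (1 * 𝟙 (right e == right f)) ≡ 1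
      partner≡1 = cong₂ (λ a b → a * (1 * 𝟙 b)) (H-at-u≡1 He u≡left) (==-≡ right≡)

  lonely≤ : sum lonely ≤ far-degrees
  lonely≤ = begin
    sum lonely
      ≡⟨ sum-cong-≗ (λ f → sym (trans (cong (_* lonely f) (sum-𝟙== (left f)))
                                       (*-identityˡ (lonely f)))) ⟩
    sum (λ f → sum (λ v → 𝟙 (v == left f)) * lonely f)
      ≡⟨ sum-cong-≗ (λ f → *-distribʳ-sum (lonely f) (λ v → 𝟙 (v == left f))) ⟩
    sum (λ f → sum (λ v → 𝟙 (v == left f) * lonely f))
      ≡⟨ ∑-comm (λ f v → 𝟙 (v == left f) * lonely f) ⟩
    sum (λ v → sum (λ f → 𝟙 (v == left f) * lonely f))
      ≤⟨ sum-mono-≤ lonely-at≤ ⟩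
    sum (λ v → sum (λ e → H-at-u e * μ v (right e)))
      ≡⟨ ∑-comm (λ v e → H-at-u e * μ v (right e)) ⟩
    sum (λ e → sum (λ v → H-at-u e * μ v (right e)))
      ≡⟨ sum-cong-≗ (λ e → sym (*-distribˡ-sum (H-at-u e) (λ v → μ v (right e)))) ⟩
    sum (λ e → H-at-u e * sum (λ v → μ v (right e)))
      ≤⟨ sum-mono-≤ (λ e → *-monoʳ-≤ (H-at-u e) (sum-μ≤deg (right e))) ⟩
    far-degrees ∎
    where open ≤-Reasoning

  size≤ : size G H ≤ D * D̃ + far-degrees
  size≤ = begin
    size G H
      ≡⟨ size≡sum G H ⟩
    sum (λ f → 𝟙 (H f))
      ≤⟨ sum-mono-≤ 𝟙H≤partnered+lonely ⟩
    sum (λ f → 𝟙 (H f) * partners f + lonely f)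
      ≡⟨ ∑-distrib-+ (λ f → 𝟙 (H f) * partners f) lonely ⟩
    sum (λ f → 𝟙 (H f) * partners f) + sum lonely
      ≤⟨ +-mono-≤ partnered≤ lonely≤ ⟩
    D * D̃ + far-degrees ∎
    where open ≤-Reasoning

  deg-u+deg-right≤σ : ∀ e → H-at-u e * (deg G u + deg G (right e)) ≤ H-at-u e * σ G H
  deg-u+deg-right≤σ e with H e in He | u ≟ left e
  ... | false | _ = z≤n
  ... | true | no _ = z≤n
  ... | true | yes u≡left = *-monoʳ-≤ 1 (begin
    deg G u + deg G (right e)               ≡⟨ cong (λ w → deg G w + deg G (right e)) u≡left ⟩
    deg G (left e) + deg G (right e)        ≡⟨ left+right≡end₁+end₂ (deg G) e ⟩
    deg G (end₁ G e) + deg G (end₂ G e)     ≤⟨ deg-ends≤σ G H e He ⟩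
    σ G H                                   ∎)
    where open ≤-Reasoning

  D*deg-u+far≤D*σ : D * deg G u + far-degrees ≤ D * σ G H
  D*deg-u+far≤D*σ = begin
    D * deg G u + far-degrees
      ≡⟨ cong (_+ far-degrees) (trans (cong (_* deg G u) D≡sum) (*-distribʳ-sum (deg G u) H-at-u)) ⟩
    sum (λ e → H-at-u e * deg G u) + far-degrees
      ≡⟨ sym (∑-distrib-+ (λ e → H-at-u e * deg G u) (λ e → H-at-u e * deg G (right e))) ⟩
    sum (λ e → H-at-u e * deg G u + H-at-u e * deg G (right e))
      ≡⟨ sum-cong-≗ (λ e → sym (*-distribˡ-+ (H-at-u e) (deg G u) (deg G (right e)))) ⟩
    sum (λ e → H-at-u e * (deg G u + deg G (right e)))
      ≤⟨ sum-mono-≤ deg-u+deg-right≤σ ⟩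
    sum (λ e → H-at-u e * σ G H)
      ≡⟨ sym (*-distribʳ-sum (σ G H) H-at-u) ⟩
    sum H-at-u * σ G H
      ≡⟨ cong (_* σ G H) (sym D≡sum) ⟩
    D * σ G H ∎
    where open ≤-Reasoning

  size≤D*[σ∸D] : size G H ≤ D * (σ G H ∸ D)
  size≤D*[σ∸D] = x≤d*a+l∧d*[d+a]+l≤d*s⇒x≤d*[s∸d] {d = D} {D̃} {far-degrees} {σ G H} size≤
                   (subst (λ d → D * d + far-degrees ≤ D * σ G H) deg-u≡ D*deg-u+far≤D*σ)

Fin-inhabited? : ∀ k → Dec (Fin k)
Fin-inhabited? zero = no λ ()
Fin-inhabited? (suc k) = yes zero

theorem4 : (G : Multigraph) → Bipartite G → (H : EdgeSet G) → IsCliqueL² G H →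
    (size G H ≤ Δ G H * (σ G H ∸ Δ G H))
    × (4 * (Δ G H * (σ G H ∸ Δ G H)) ≤ σ G H * σ G H)
theorem4 G (col , proper) H clique = size≤Δ*[σ∸Δ] , 4*[m*[n∸m]]≤n² (Δ G H) (σ G H)
  where
  size≤Δ*[σ∸Δ] : size G H ≤ Δ G H * (σ G H ∸ Δ G H)
  size≤Δ*[σ∸Δ] with Fin-inhabited? (n G)
  ... | no no-vertex = subst (_≤ Δ G H * (σ G H ∸ Δ G H)) (sym (size≡0 G H no-vertex)) z≤n
  ... | yes v with Δ-attained G H v
  ...   | u , Δ≡degIn-u = subst (λ d → size G H ≤ d * (σ G H ∸ d)) (sym Δ≡degIn-u)
          (CliqueBound.size≤D*[σ∸D] G col proper H clique u u-max)
    where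
    u-max : ∀ w → degIn G H w ≤ degIn G H u
    u-max w = subst (degIn G H w ≤_) Δ≡degIn-u (degIn≤Δ G H w)
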